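{- Let $\{m_I\mid I\in\Sigma\}$, $m_I=\prod_{i\in I}x_i^{\nu_I(i)}$, be a monotone monomial family in $\mathbb{K}[x_1,\dots,x_n]$ such that $\Sigma$ contains all one-element subsets of $\{1,\dots,n\}$, and put $\nu(i)=\nu_{\{i\}}(i)$. Let $\mathcal{A}=\mathbb{K}[x_1,\dots,x_n]/\langle m_I\mid I\in\Sigma\rangle$. Then $$\dim\mathcal{A}=\sum_{I_1\subsetneq\cdots\subsetneq I_k}(-1)^k\prod_{r=1}^{k}\ \prod_{i\in I_r\setminus I_{r-1}}\bigl(\nu(i)-\nu_{I_r}(i)\bigr)\times\prod_{i\notin I_k}\nu(i),$$ where $I_0=\emptyset$, the product $\prod_{i\notin I_k}$ is over $i\in\{1,\dots,n\}\setminus I_k$, and the sum is over all strictly increasing chains of sets of $\Sigma$ of all lengths $k\ge0$, including the empty chain ($k=0$, contributing $\prod_{i=1}^n\nu(i)$).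
   Context: $\mathbb{K}$ is a field; $\Sigma$ is a set of nonempty subsets of $\{1,\dots,n\}$. Monotone monomial family: (MM1) $m_I$ involves only $x_i$, $i\in I$; (MM2) $\nu_I(i)\ge\nu_J(i)$ whenever $I\subset J$ in $\Sigma$ and $i\in I$; (MM3) for $I,J\in\Sigma$ some $K\in\Sigma$, $K\supseteq I\cup J$, has $m_K\mid\mathrm{lcm}(m_I,m_J)$. -}

module Defs where

open import Level using (Level; _⊔_)
open import Data.Nat as ℕ using (ℕ; zero; suc)
open import Data.Bool using (Bool; true; false; if_then_else_)
open import Data.Fin using (Fin)
open import Data.Fin.Subset using (Subset; inside; outside; _⊂_; ∁; _─_; ⁅_⁆)
open import Data.Fin.Subset.Properties using (_⊂?_)
open import Data.Vec as Vec using (Vec; []; _∷_; lookup; tabulate; zipWith)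
open import Data.Vec.Properties using (≡-dec)
open import Data.List as List using (List; []; _∷_; _++_; map; concatMap; foldr; allFin; upTo)
open import Data.Product using (Σ; Σ-syntax; _×_; _,_)
open import Data.Unit using (⊤; tt)
open import Data.Integer as ℤ using (ℤ; +_)
open import Algebra.Bundles using (CommutativeRing)
open import Relation.Nullary using (¬_; Dec; yes; no; does)
open import Relation.Nullary.Decidable using (_×-dec_)
open import Relation.Unary using (Decidable)
import Data.Nat.Properties as ℕP

record Field (c ℓ : Level) : Set (Level.suc (c ⊔ ℓ)) where
  field
    commutativeRing : CommutativeRing c ℓ
  open CommutativeRing commutativeRing public
  field
    0≉1     : ¬ (0# ≈ 1#)
    inverse : ∀ x → ¬ (x ≈ 0#) → Σ[ y ∈ Carrier ] (x * y ≈ 1#)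

module PolyRing {c ℓ} (F : Field c ℓ) (n : ℕ) where
  open Field F

  -- exponent vectors; x^α = ∏ x_i^{α i}
  Mon : Set
  Mon = Vec ℕ n

  -- a polynomial is a finite formal sum of terms c·x^α
  Poly : Set c
  Poly = List (Carrier × Mon)

  coeff : Poly → Mon → Carrier
  coeff p α = foldr (λ { (a , β) acc → if does (≡-dec ℕP._≟_ β α) then a + acc else acc }) 0# p

  _≈ₚ_ : Poly → Poly → Set ℓ
  p ≈ₚ q = ∀ α → coeff p α ≈ coeff q α

  _+ₚ_ : Poly → Poly → Poly
  p +ₚ q = p ++ q

  -ₚ_ : Poly → Poly
  -ₚ p = map (λ { (a , β) → (- a , β) }) p

  _*ₚ_ : Poly → Poly → Poly
  p *ₚ q = concatMap (λ { (a , β) → map (λ { (b , γ) → (a * b , zipWith ℕ._+_ β γ) }) q }) p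

  scale : Carrier → Poly → Poly
  scale a p = map (λ { (b , γ) → (a * b , γ) }) p

  0ₚ : Poly
  0ₚ = []

  sumₚ : List Poly → Poly
  sumₚ = foldr _+ₚ_ 0ₚ

  monomial : Mon → Poly
  monomial α = (1# , α) ∷ []

  InIdeal : {Ix : Set} (P : Ix → Set) (gen : Ix → Mon) → Poly → Set (c ⊔ ℓ)
  InIdeal {Ix} P gen p =
    Σ[ L ∈ List (Poly × Σ[ j ∈ Ix ] P j) ]
      (p ≈ₚ sumₚ (map (λ { (g , (j , _)) → g *ₚ monomial (gen j) }) L))

  lincomb : {d : ℕ} → (Fin d → Carrier) → (Fin d → Poly) → Poly
  lincomb {d} a b = sumₚ (map (λ j → scale (a j) (b j)) (allFin d))

  -- dim_K ( K[x]/J ) = d, where J is given by its membership predicate: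
  -- there are d polynomials whose classes form a K-basis of K[x]/J.
  QuotientDim : (Poly → Set (c ⊔ ℓ)) → ℕ → Set (c ⊔ ℓ)
  QuotientDim InJ d =
    Σ[ b ∈ (Fin d → Poly) ]
      ( (∀ p → Σ[ a ∈ (Fin d → Carrier) ] InJ (p +ₚ (-ₚ lincomb a b)))
      × (∀ (a : Fin d → Carrier) → InJ (lincomb a b) → ∀ j → a j ≈ 0#) )

module Family {n : ℕ} (S : Subset n → Set) (S? : Decidable S)
              (ν : Subset n → Fin n → ℕ) where

  expo : Subset n → Vec ℕ n
  expo I = tabulate (λ i → if lookup I i then ν I i else 0)

  ν₁ : Fin n → ℕ
  ν₁ i = ν ⁅ i ⁆ i

  prodAll : (Fin n → ℤ) → ℤ
  prodAll f = foldr ℤ._*_ (+ 1) (map f (allFin n))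

  prodOn : Subset n → (Fin n → ℤ) → ℤ
  prodOn A f = prodAll (λ i → if lookup A i then f i else + 1)

  sumℤ : List ℤ → ℤ
  sumℤ = foldr ℤ._+_ (+ 0)

  allSubsets : (m : ℕ) → List (Subset m)
  allSubsets zero = [] ∷ []
  allSubsets (suc m) = concatMap (λ v → (inside ∷ v) ∷ (outside ∷ v) ∷ []) (allSubsets m)

  allLists : ℕ → List (List (Subset n))
  allLists zero = [] ∷ []
  allLists (suc k) = concatMap (λ I → map (I ∷_) (allLists k)) (allSubsets n)

  ChainAbove : Subset n → List (Subset n) → Set
  ChainAbove prev [] = ⊤
  ChainAbove prev (I ∷ L) = S I × (prev ⊂ I) × ChainAbove I L

  chainAbove? : ∀ prev L → Dec (ChainAbove prev L)
  chainAbove? prev [] = yes tt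
  chainAbove? prev (I ∷ L) = S? I ×-dec ((prev ⊂? I) ×-dec chainAbove? I L)

  IsChain : List (Subset n) → Set
  IsChain = ChainAbove Data.Fin.Subset.⊥

  chainProd : Subset n → List (Subset n) → ℤ
  chainProd prev [] = prodOn (∁ prev) (λ i → + ν₁ i)
  chainProd prev (I ∷ L) =
    prodOn (I ─ prev) (λ i → (+ ν₁ i) ℤ.- (+ ν I i)) ℤ.* chainProd I L

  sign : ℕ → ℤ
  sign zero = + 1
  sign (suc k) = ℤ.- sign k

  chainTerm : List (Subset n) → ℤ
  chainTerm L = sign (List.length L) ℤ.* chainProd Data.Fin.Subset.⊥ L

  -- sum over all strict chains in Σ (of length k = 0,…,n; longer strict
  -- chains of nonempty subsets of an n-element set do not exist)
  chainSum : ℤ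
  chainSum = sumℤ (concatMap
    (λ k → map (λ L → if does (chainAbove? Data.Fin.Subset.⊥ L) then chainTerm L else + 0) (allLists k))
    (upTo (suc n)))

module Submission where

-- The monomials x^α not divisible by any m_I ("standard" monomials) form a K-basis of A, and since
-- every x_i^ν(i) is a generator they all lie in the box B = {α : α_i < ν(i)}.  For a chain
-- I₁ ⊊ ⋯ ⊊ I_k, MM2 makes the exponent of x_i in lcm(m_{I₁},…,m_{I_k}) equal to ν_{I_r}(i) for the
-- first I_r containing i, so the chain's product counts the α ∈ B divisible by that lcm.
-- Exchanging the sums, the right-hand side becomes Σ_{α ∈ B} of the alternating count of chains
-- in P_α = {I ∈ Σ : m_I ∣ x^α}.  This is 1 when P_α is empty; otherwise MM3 gives P_α a greatest
-- element M, chains ending in M cancel against those that do not, and the contribution is 0.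
-- What remains is the number of standard monomials.

open import Defs
open import Level using (Level)
open import Data.Nat using (ℕ; _≤_; _⊔_)
open import Data.Fin using (Fin)
open import Data.Fin.Subset using (Subset; Nonempty; _⊂_; _⊆_; _∈_; _∪_; ⁅_⁆)
open import Data.Vec using (lookup)
open import Data.Product using (Σ-syntax; _×_)
open import Data.Integer using (+_)
open import Relation.Unary using (Decidable)
open import Relation.Binary.PropositionalEquality using (_≡_)

open import Algebra.Bundles using (CommutativeSemiring)
import Algebra.Properties.CommutativeSemigroup as CommutativeSemigroupProperties
open import Data.Bool as Bool using (true; false; if_then_else_)
open import Data.Nat as ℕ using (zero; suc; z≤n; s≤s; _≤?_; _∸_)
import Data.Nat.Properties as ℕP
open import Data.Fin using (zero; suc)
open import Data.Fin.Properties using (suc-injective; all?; ¬∀⟶∃¬)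
open import Data.Fin.Subset using (inside; outside; ⊥; ∣_∣; ∁; _─_)
open import Data.Fin.Subset.Properties
  using (_⊂?_; anySubset?; x∈⁅x⁆; x∈⁅y⁆⇒x≡y; drop-∷-⊆; s⊂s; out⊂in; ⊥⊆; ∉⊥; ∣⊥∣≡0; ∣p∣≤n; p⊂q⇒∣p∣<∣q∣;
         p⊆p∪q; q⊆p∪q)
open import Data.Vec as Vec using (Vec; zipWith)
open import Data.Vec.Properties
  using (≡-dec; ∷-injective; lookup-zipWith; lookup∘tabulate; lookup-map; lookup-replicate; []=⇒lookup; lookup⇒[]=)
open import Data.List as List
  using (List; []; _∷_; _++_; map; concatMap; foldr; allFin; upTo; filter; length; cartesianProductWith)
import Data.List.Properties as LP
open import Data.List.Membership.Propositional using () renaming (_∈_ to _∈ₗ_)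
open import Data.List.Membership.Propositional.Properties
  using (∈-allFin; ∈-upTo⁺; ∈-concatMap⁺; ∈-lookup; ∈-cartesianProductWith⁺; ∈-filter⁺; ∈-filter⁻)
import Data.List.Relation.Unary.All as All
import Data.List.Relation.Unary.Any as Any
open Any using (here; there)
open import Data.List.Relation.Unary.Any.Properties using (lookup-index)
open import Data.List.Relation.Unary.AllPairs as AllPairs using (_∷_)
open import Data.List.Relation.Unary.Unique.Propositional using (Unique)
open import Data.List.Relation.Unary.Unique.Propositional.Properties using (cartesianProductWith⁺; upTo⁺; filter⁺)
import Data.Integer.Properties as ℤP
open import Data.Integer.Tactic.RingSolver using (solve-∀)
open import Data.Product using (Σ; ∃; _,_; proj₁; proj₂)
open import Function using (_∘_; id)
open import Relation.Nullary using (Dec; yes; no; does; ¬_; ¬?; _×-dec_; contradiction)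
open import Relation.Unary using (Pred)
import Relation.Binary.PropositionalEquality as ≡
open ≡ using (_≢_)

-- Finite sums and products

map-allFin-suc : ∀ {a} {A : Set a} {d} (f : Fin (suc d) → A) →
                 map f (allFin (suc d)) ≡ f zero ∷ map (f ∘ suc) (allFin d)
map-allFin-suc f = ≡.trans (LP.map-tabulate id f) (≡.cong (f zero ∷_) (≡.sym (LP.map-tabulate id (f ∘ suc))))

module BigOperators {c ℓ} (R : CommutativeSemiring c ℓ) where
  open CommutativeSemiring R hiding (zero)
  open import Relation.Binary.Reasoning.Setoid setoid

  ∑ ∏ : List Carrier → Carrier
  ∑ = foldr _+_ 0#
  ∏ = foldr _*_ 1#

  module _ {a} {A : Set a} where

    ∑-cong : ∀ {f g : A → Carrier} → (∀ x → f x ≈ g x) → ∀ xs → ∑ (map f xs) ≈ ∑ (map g xs)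
    ∑-cong f≈g []       = refl
    ∑-cong f≈g (x ∷ xs) = +-cong (f≈g x) (∑-cong f≈g xs)

    ∏-cong : ∀ {f g : A → Carrier} → (∀ x → f x ≈ g x) → ∀ xs → ∏ (map f xs) ≈ ∏ (map g xs)
    ∏-cong f≈g []       = refl
    ∏-cong f≈g (x ∷ xs) = *-cong (f≈g x) (∏-cong f≈g xs)

    ∑-zero : ∀ {f : A → Carrier} → (∀ x → f x ≈ 0#) → ∀ xs → ∑ (map f xs) ≈ 0#
    ∑-zero f≈0 []       = refl
    ∑-zero f≈0 (x ∷ xs) = trans (+-cong (f≈0 x) (∑-zero f≈0 xs)) (+-identityˡ 0#)

    ∏-zero : ∀ (f : A → Carrier) {x xs} → x ∈ₗ xs → f x ≈ 0# → ∏ (map f xs) ≈ 0#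
    ∏-zero f {xs = y ∷ ys} (here ≡.refl) fx≈0 = trans (*-congʳ fx≈0) (zeroˡ _)
    ∏-zero f {xs = y ∷ ys} (there x∈ys) fx≈0 = trans (*-congˡ (∏-zero f x∈ys fx≈0)) (zeroʳ _)

    ∏-one : ∀ {f : A → Carrier} → (∀ x → f x ≈ 1#) → ∀ xs → ∏ (map f xs) ≈ 1#
    ∏-one f≈1 []       = refl
    ∏-one f≈1 (x ∷ xs) = trans (*-cong (f≈1 x) (∏-one f≈1 xs)) (*-identityˡ 1#)

    ∑-+ : ∀ (f g : A → Carrier) xs → ∑ (map (λ x → f x + g x) xs) ≈ ∑ (map f xs) + ∑ (map g xs)
    ∑-+ f g []       = sym (+-identityˡ 0#)
    ∑-+ f g (x ∷ xs) = trans (+-congˡ (∑-+ f g xs)) (CommutativeSemigroupProperties.interchange +-commutativeSemigroup _ _ _ _)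

    ∏-* : ∀ (f g : A → Carrier) xs → ∏ (map (λ x → f x * g x) xs) ≈ ∏ (map f xs) * ∏ (map g xs)
    ∏-* f g []       = sym (*-identityˡ 1#)
    ∏-* f g (x ∷ xs) = trans (*-congˡ (∏-* f g xs)) (CommutativeSemigroupProperties.interchange *-commutativeSemigroup _ _ _ _)

    ∑-distribˡ : ∀ a (f : A → Carrier) xs → ∑ (map (λ x → a * f x) xs) ≈ a * ∑ (map f xs)
    ∑-distribˡ a f []       = sym (zeroʳ a)
    ∑-distribˡ a f (x ∷ xs) = trans (+-congˡ (∑-distribˡ a f xs)) (sym (distribˡ a _ _))

    ∑-distribʳ : ∀ a (f : A → Carrier) xs → ∑ (map (λ x → f x * a) xs) ≈ ∑ (map f xs) * a
    ∑-distribʳ a f []       = sym (zeroˡ a)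
    ∑-distribʳ a f (x ∷ xs) = trans (+-congˡ (∑-distribʳ a f xs)) (sym (distribʳ a _ _))

    ∑-++ : ∀ (f : A → Carrier) xs ys → ∑ (map f (xs ++ ys)) ≈ ∑ (map f xs) + ∑ (map f ys)
    ∑-++ f []       ys = sym (+-identityˡ _)
    ∑-++ f (x ∷ xs) ys = trans (+-congˡ (∑-++ f xs ys)) (sym (+-assoc _ _ _))

  module _ {a b} {A : Set a} {B : Set b} where

    ∑-concatMap : ∀ (f : B → Carrier) (g : A → List B) xs →
                  ∑ (map f (concatMap g xs)) ≈ ∑ (map (λ x → ∑ (map f (g x))) xs)
    ∑-concatMap f g []       = refl
    ∑-concatMap f g (x ∷ xs) = trans (∑-++ f (g x) (concatMap g xs)) (+-congˡ (∑-concatMap f g xs))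

    ∑-comm : ∀ (f : A → B → Carrier) xs ys →
             ∑ (map (λ x → ∑ (map (f x) ys)) xs) ≈ ∑ (map (λ y → ∑ (map (λ x → f x y) xs)) ys)
    ∑-comm f []       ys = sym (∑-zero (λ _ → refl) ys)
    ∑-comm f (x ∷ xs) ys = trans (+-congˡ (∑-comm f xs ys)) (sym (∑-+ (f x) _ ys))

    ∑-map : ∀ (f : B → Carrier) (g : A → B) xs → ∑ (map f (map g xs)) ≈ ∑ (map (f ∘ g) xs)
    ∑-map f g []       = refl
    ∑-map f g (x ∷ xs) = +-congˡ (∑-map f g xs)

  module _ {a b d} {A : Set a} {B : Set b} {D : Set d} where

    ∑-cartesianProductWith : ∀ (F : D → Carrier) (f : A → B → D) xs ys →
      ∑ (map F (cartesianProductWith f xs ys)) ≈ ∑ (map (λ x → ∑ (map (F ∘ f x) ys)) xs)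
    ∑-cartesianProductWith F f []       ys = refl
    ∑-cartesianProductWith F f (x ∷ xs) ys =
      trans (∑-++ F (map (f x) ys) _) (+-cong (∑-map F (f x) ys) (∑-cartesianProductWith F f xs ys))

  ∑-allFin-δ : ∀ {d} (f : Fin d → Carrier) j → (∀ i → i ≢ j → f i ≈ 0#) → ∑ (map f (allFin d)) ≈ f j
  ∑-allFin-δ {suc d} f j f≈0 = trans (reflexive (≡.cong ∑ (map-allFin-suc f))) (split j f≈0)
    where
    split : ∀ j → (∀ i → i ≢ j → f i ≈ 0#) → f zero + ∑ (map (f ∘ suc) (allFin d)) ≈ f j
    split zero    f≈0 = trans (+-congˡ (∑-zero (λ i → f≈0 (suc i) λ ()) (allFin d))) (+-identityʳ _)
    split (suc j) f≈0 = trans (+-congʳ (f≈0 zero λ ())) (trans (+-identityˡ _)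
                          (∑-allFin-δ (f ∘ suc) j λ i i≢j → f≈0 (suc i) (i≢j ∘ suc-injective)))

-- Standard monomials form a basis of the quotient

lookup-injective : ∀ {a} {A : Set a} {xs : List A} → Unique xs →
                   ∀ i j → List.lookup xs i ≡ List.lookup xs j → i ≡ j
lookup-injective (_ ∷ _)              zero    zero    _  = ≡.refl
lookup-injective (x∉xs ∷ _)           zero    (suc j) eq = contradiction eq (All.lookup x∉xs (∈-lookup j))
lookup-injective (x∉xs ∷ _)           (suc i) zero    eq = contradiction (≡.sym eq) (All.lookup x∉xs (∈-lookup i))
lookup-injective (_ ∷ unique)         (suc i) (suc j) eq = ≡.cong suc (lookup-injective unique i j eq)

_∣ₘ_ : ∀ {n} → Vec ℕ n → Vec ℕ n → Set
u ∣ₘ v = ∀ i → lookup u i ≤ lookup v i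

_∣ₘ?_ : ∀ {n} (u v : Vec ℕ n) → Dec (u ∣ₘ v)
u ∣ₘ? v = all? (λ i → lookup u i ≤? lookup v i)

u∣ₘγ+u : ∀ {n} (γ u : Vec ℕ n) → u ∣ₘ zipWith ℕ._+_ γ u
u∣ₘγ+u γ u i rewrite lookup-zipWith ℕ._+_ i γ u = ℕP.m≤n+m (lookup u i) (lookup γ i)

v∸u+u≡v : ∀ {n} (u v : Vec ℕ n) → u ∣ₘ v → zipWith ℕ._+_ (zipWith _∸_ v u) u ≡ v
v∸u+u≡v Vec.[]        Vec.[]        u∣v = ≡.refl
v∸u+u≡v (x Vec.∷ u) (y Vec.∷ v) u∣v = ≡.cong₂ Vec._∷_ (ℕP.m∸n+n≡m (u∣v zero)) (v∸u+u≡v u v (u∣v ∘ suc))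

module Coefficients {c ℓ} (K : Field c ℓ) (n : ℕ) where
  open PolyRing K n
  open Field K hiding (zero)
  open import Relation.Binary.Reasoning.Setoid setoid
  open import Algebra.Properties.Ring ring using (-‿+-comm; -0#≈0#)
  module Σᴷ = BigOperators commutativeSemiring

  coeff-++ : ∀ p q α → coeff (p ++ q) α ≈ coeff p α + coeff q α
  coeff-++ []            q α = sym (+-identityˡ _)
  coeff-++ ((a , β) ∷ p) q α with ≡-dec ℕP._≟_ β α
  ... | yes _ = trans (+-congˡ (coeff-++ p q α)) (sym (+-assoc a _ _))
  ... | no _  = coeff-++ p q α

  coeff-neg : ∀ p α → coeff (-ₚ p) α ≈ - coeff p α
  coeff-neg []            α = sym -0#≈0#
  coeff-neg ((a , β) ∷ p) α with ≡-dec ℕP._≟_ β α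
  ... | yes _ = trans (+-congˡ (coeff-neg p α)) (-‿+-comm a _)
  ... | no _  = coeff-neg p α

  coeff-scale : ∀ x p α → coeff (scale x p) α ≈ x * coeff p α
  coeff-scale x []            α = sym (zeroʳ x)
  coeff-scale x ((a , β) ∷ p) α with ≡-dec ℕP._≟_ β α
  ... | yes _ = trans (+-congˡ (coeff-scale x p α)) (sym (distribˡ x a _))
  ... | no _  = coeff-scale x p α

  coeff-monomial : ∀ α → coeff (monomial α) α ≈ 1#
  coeff-monomial α with ≡-dec ℕP._≟_ α α
  ... | yes _   = +-identityʳ 1#
  ... | no α≢α  = contradiction ≡.refl α≢α

  coeff-monomial-≢ : ∀ {β α} → β ≢ α → coeff (monomial β) α ≈ 0#
  coeff-monomial-≢ {β} {α} β≢α with ≡-dec ℕP._≟_ β α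
  ... | yes β≡α = contradiction β≡α β≢α
  ... | no _    = refl

  coeff-sumₚ : ∀ {a} {A : Set a} (F : A → Poly) xs α →
               coeff (sumₚ (map F xs)) α ≈ Σᴷ.∑ (map (λ x → coeff (F x) α) xs)
  coeff-sumₚ F []       α = refl
  coeff-sumₚ F (x ∷ xs) α = trans (coeff-++ (F x) _ α) (+-congˡ (coeff-sumₚ F xs α))

  coeff-lincomb : ∀ {d} (a : Fin d → Carrier) (b : Fin d → Poly) α →
                  coeff (lincomb a b) α ≈ Σᴷ.∑ (map (λ j → a j * coeff (b j) α) (allFin d))
  coeff-lincomb {d} a b α =
    trans (coeff-sumₚ (λ j → scale (a j) (b j)) (allFin d) α) (Σᴷ.∑-cong (λ j → coeff-scale (a j) (b j) α) (allFin d))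

  coeff-*-monomial : ∀ g e α → (∀ γ → zipWith ℕ._+_ γ e ≢ α) → coeff (g *ₚ monomial e) α ≈ 0#
  coeff-*-monomial []            e α _     = refl
  coeff-*-monomial ((x , γ) ∷ g) e α γ+e≢α with ≡-dec ℕP._≟_ (zipWith ℕ._+_ γ e) α
  ... | yes γ+e≡α = contradiction γ+e≡α (γ+e≢α γ)
  ... | no _      = coeff-*-monomial g e α γ+e≢α

module StandardMonomials {c ℓ} (K : Field c ℓ) (n : ℕ) {Ix : Set} (Sx : Ix → Set) (gen : Ix → Vec ℕ n) where
  open PolyRing K n
  open Field K hiding (zero)
  open Coefficients K n
  open import Algebra.Properties.Ring ring using (-0#≈0#)
  open import Relation.Binary.Reasoning.Setoid setoid

  Divisible : Mon → Set
  Divisible α = Σ[ i ∈ Ix ] (Sx i × gen i ∣ₘ α)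

  generatorMultiple : Poly × Σ Ix Sx → Poly
  generatorMultiple (g , i , _) = g *ₚ monomial (gen i)

  coeff-generatorMultiple : ∀ {α} → ¬ Divisible α → ∀ y → coeff (generatorMultiple y) α ≈ 0#
  coeff-generatorMultiple ¬div (g , i , si) =
    coeff-*-monomial g (gen i) _ λ { γ ≡.refl → ¬div (i , si , u∣ₘγ+u γ (gen i)) }

  -- InIdeal is stated with an anonymous pattern-matching lambda; these two lemmas trade it for generatorMultiple.
  InIdeal-intro : ∀ p L → p ≈ₚ sumₚ (map generatorMultiple L) → InIdeal Sx gen p
  InIdeal-intro p L p≈ = L , λ α →
    trans (p≈ α) (reflexive (≡.cong (λ q → coeff (sumₚ q) α) (LP.map-cong (λ { (g , i , si) → ≡.refl }) L)))

  InIdeal-elim : ∀ p → InIdeal Sx gen p → Σ[ L ∈ List (Poly × Σ Ix Sx) ] (p ≈ₚ sumₚ (map generatorMultiple L))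
  InIdeal-elim p (L , p≈) = L , λ α →
    trans (p≈ α) (reflexive (≡.cong (λ q → coeff (sumₚ q) α) (LP.map-cong (λ { (g , i , si) → ≡.refl }) L)))

  InIdeal-coeff : ∀ p α → InIdeal Sx gen p → ¬ Divisible α → coeff p α ≈ 0#
  InIdeal-coeff p α inIdeal ¬div with InIdeal-elim p inIdeal
  ... | L , p≈ = begin
    coeff p α                                                 ≈⟨ p≈ α ⟩
    coeff (sumₚ (map generatorMultiple L)) α                  ≈⟨ coeff-sumₚ generatorMultiple L α ⟩
    Σᴷ.∑ (map (λ y → coeff (generatorMultiple y) α) L)        ≈⟨ Σᴷ.∑-zero (coeff-generatorMultiple {α} ¬div) L ⟩
    0#                                                        ∎

  module Basis (divisible? : ∀ α → Dec (Divisible α)) (s : List Mon) (s-unique : Unique s)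
               (standard : ∀ {α} → α ∈ₗ s → ¬ Divisible α) (complete : ∀ {α} → ¬ Divisible α → α ∈ₗ s) where

    basis : Fin (length s) → Poly
    basis j = monomial (List.lookup s j)

    coeff-combination-lookup : ∀ a j → coeff (lincomb a basis) (List.lookup s j) ≈ a j
    coeff-combination-lookup a j = begin
      coeff (lincomb a basis) (List.lookup s j)                                 ≈⟨ coeff-lincomb a basis _ ⟩
      Σᴷ.∑ (map (λ i → a i * coeff (basis i) (List.lookup s j)) (allFin _))     ≈⟨ Σᴷ.∑-allFin-δ _ j off-diagonal ⟩
      a j * coeff (basis j) (List.lookup s j)                                   ≈⟨ *-congˡ (coeff-monomial (List.lookup s j)) ⟩
      a j * 1#                                                                  ≈⟨ *-identityʳ (a j) ⟩
      a j                                                                       ∎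
      where
      off-diagonal : ∀ i → i ≢ j → a i * coeff (basis i) (List.lookup s j) ≈ 0#
      off-diagonal i i≢j = trans (*-congˡ (coeff-monomial-≢ (i≢j ∘ lookup-injective s-unique i j))) (zeroʳ (a i))

    coeff-combination-∈ : ∀ a {α} (α∈s : α ∈ₗ s) → coeff (lincomb a basis) α ≈ a (Any.index α∈s)
    coeff-combination-∈ a α∈s =
      ≡.subst (λ β → coeff (lincomb a basis) β ≈ a (Any.index α∈s)) (≡.sym (lookup-index α∈s))
        (coeff-combination-lookup a (Any.index α∈s))

    coeff-combination-∉ : ∀ a {α} → ¬ α ∈ₗ s → coeff (lincomb a basis) α ≈ 0#
    coeff-combination-∉ a {α} α∉s = trans (coeff-lincomb a basis α) (Σᴷ.∑-zero vanish (allFin _))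
      where
      vanish : ∀ i → a i * coeff (basis i) α ≈ 0#
      vanish i = trans (*-congˡ (coeff-monomial-≢ {List.lookup s i} {α} λ { ≡.refl → α∉s (∈-lookup i) })) (zeroʳ (a i))

    idealTerms : Poly → List (Poly × Σ Ix Sx)
    idealTerms []            = []
    idealTerms ((x , β) ∷ p) with divisible? β
    ... | yes (i , si , _) = ((x , zipWith _∸_ β (gen i)) ∷ [] , i , si) ∷ idealTerms p
    ... | no _             = idealTerms p

    coeff-reduced : ∀ x β {i} (si : Sx i) α → gen i ∣ₘ β →
      coeff (generatorMultiple ((x , zipWith _∸_ β (gen i)) ∷ [] , i , si)) α ≈ coeff ((x , β) ∷ []) α
    coeff-reduced x β {i} si α gi∣β =
      ≡.subst (λ γ → coeff ((x * 1# , γ) ∷ []) α ≈ coeff ((x , β) ∷ []) α) (≡.sym (v∸u+u≡v (gen i) β gi∣β)) unit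
      where
      unit : coeff ((x * 1# , β) ∷ []) α ≈ coeff ((x , β) ∷ []) α
      unit with ≡-dec ℕP._≟_ β α
      ... | yes _ = +-congʳ (*-identityʳ x)
      ... | no _  = refl

    coeff-idealTerms : ∀ p {α} → Divisible α →
      Σᴷ.∑ (map (λ y → coeff (generatorMultiple y) α) (idealTerms p)) ≈ coeff p α
    coeff-idealTerms []            div = refl
    coeff-idealTerms ((x , β) ∷ p) {α} div with divisible? β
    ... | yes (i , si , gi∣β) =
      trans (+-cong (coeff-reduced x β si α gi∣β) (coeff-idealTerms p div)) (sym (coeff-++ ((x , β) ∷ []) p α))
    ... | no ¬divβ = trans (coeff-idealTerms p div) (sym skip)
      where
      skip : coeff ((x , β) ∷ p) α ≈ coeff p α
      skip with ≡-dec ℕP._≟_ β α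
      ... | yes ≡.refl = contradiction div ¬divβ
      ... | no _       = refl

    spanning : ∀ p → Σ[ a ∈ (Fin (length s) → Carrier) ] InIdeal Sx gen (p +ₚ (-ₚ lincomb a basis))
    spanning p = a , InIdeal-intro (p +ₚ (-ₚ lincomb a basis)) (idealTerms p) λ α → begin
      coeff (p +ₚ (-ₚ lincomb a basis)) α                               ≈⟨ coeff-++ p _ α ⟩
      coeff p α + coeff (-ₚ lincomb a basis) α                          ≈⟨ +-congˡ (coeff-neg (lincomb a basis) α) ⟩
      coeff p α - coeff (lincomb a basis) α                             ≈⟨ remainder α ⟩
      Σᴷ.∑ (map (λ y → coeff (generatorMultiple y) α) (idealTerms p))   ≈⟨ coeff-sumₚ generatorMultiple (idealTerms p) α ⟨
      coeff (sumₚ (map generatorMultiple (idealTerms p))) α             ∎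
      where
      a : Fin (length s) → Carrier
      a j = coeff p (List.lookup s j)
      remainder : ∀ α → coeff p α - coeff (lincomb a basis) α
                        ≈ Σᴷ.∑ (map (λ y → coeff (generatorMultiple y) α) (idealTerms p))
      remainder α with divisible? α
      ... | yes div = trans (+-congˡ (trans (-‿cong (coeff-combination-∉ a (λ α∈s → standard α∈s div))) -0#≈0#))
                        (trans (+-identityʳ _) (sym (coeff-idealTerms p div)))
      ... | no ¬div = trans (+-congˡ (-‿cong (trans (coeff-combination-∈ a α∈s)
                              (reflexive (≡.cong (coeff p) (≡.sym (lookup-index α∈s)))))))
                        (trans (-‿inverseʳ _) (sym (Σᴷ.∑-zero (coeff-generatorMultiple {α} ¬div) (idealTerms p))))
        where α∈s = complete ¬div

    independent : ∀ a → InIdeal Sx gen (lincomb a basis) → ∀ j → a j ≈ 0#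
    independent a inIdeal j = trans (sym (coeff-combination-lookup a j))
      (InIdeal-coeff (lincomb a basis) (List.lookup s j) inIdeal (standard (∈-lookup j)))

    quotientDim : QuotientDim (InIdeal Sx gen) (length s)
    quotientDim = basis , spanning , independent

-- Integer counting

open ≡ using (refl; cong)
open import Data.Integer as ℤ using (ℤ; _+_; _*_; _-_; -_)

open BigOperators ℤP.+-*-commutativeSemiring
  using (∑; ∏; ∑-cong; ∏-cong; ∑-zero; ∏-zero; ∏-one; ∑-+; ∏-*; ∑-distribˡ; ∑-distribʳ; ∑-++; ∑-concatMap;
         ∑-comm; ∑-map; ∑-cartesianProductWith)

𝟙 : ∀ {p} {A : Set p} → Dec A → ℤ
𝟙 (yes _) = + 1
𝟙 (no _)  = + 0

𝟙-* : ∀ {p} {A : Set p} (d : Dec A) x → 𝟙 d * x ≡ (if does d then x else + 0)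
𝟙-* (yes _) x = ℤP.*-identityˡ x
𝟙-* (no _)  x = ℤP.*-zeroˡ x

sign : ℕ → ℤ
sign zero    = + 1
sign (suc k) = - sign k

∏-𝟙≡𝟙-all : ∀ {n p} {P : Pred (Fin n) p} (P? : Decidable P) → ∏ (map (𝟙 ∘ P?) (allFin n)) ≡ 𝟙 (all? P?)
∏-𝟙≡𝟙-all {n} {P = P} P? with all? P?
... | yes ∀P = ∏-one 𝟙-P (allFin n)
  where 𝟙-P : ∀ i → 𝟙 (P? i) ≡ + 1
        𝟙-P i with P? i
        ... | yes _  = refl
        ... | no ¬Pi = contradiction (∀P i) ¬Pi
... | no ¬∀P with ¬∀⟶∃¬ n P P? ¬∀P
...   | i , ¬Pi = ∏-zero (𝟙 ∘ P?) (∈-allFin i) 𝟙-¬P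
  where 𝟙-¬P : 𝟙 (P? i) ≡ + 0
        𝟙-¬P with P? i
        ... | yes Pi = contradiction Pi ¬Pi
        ... | no _   = refl

∑-𝟙≡length-filter : ∀ {a p} {A : Set a} {P : Pred A p} (P? : Decidable P) xs →
                    ∑ (map (𝟙 ∘ P?) xs) ≡ + length (filter P? xs)
∑-𝟙≡length-filter P? []       = refl
∑-𝟙≡length-filter P? (x ∷ xs) with P? x
... | yes _ = cong (λ z → + 1 + z) (∑-𝟙≡length-filter P? xs)
... | no _  = ≡.trans (ℤP.+-identityˡ _) (∑-𝟙≡length-filter P? xs)

∑-upTo-suc : ∀ (f : ℕ → ℤ) N → ∑ (map f (upTo (suc N))) ≡ ∑ (map f (upTo N)) + f N
∑-upTo-suc f N = begin
  ∑ (map f (upTo (suc N)))           ≡⟨ cong (∑ ∘ map f) (≡.sym (LP.upTo-∷ʳ N)) ⟩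
  ∑ (map f (upTo N List.∷ʳ N))       ≡⟨ ∑-++ f (upTo N) (N ∷ []) ⟩
  ∑ (map f (upTo N)) + (f N + + 0)   ≡⟨ cong (λ z → ∑ (map f (upTo N)) + z) (ℤP.+-identityʳ (f N)) ⟩
  ∑ (map f (upTo N)) + f N           ∎
  where open ≡.≡-Reasoning

∑-𝟙-≤-upTo : ∀ t N → ∑ (map (λ a → 𝟙 (t ≤? a)) (upTo N)) ≡ + (N ∸ t)
∑-𝟙-≤-upTo t zero    = cong +_ (≡.sym (ℕP.0∸n≡0 t))
∑-𝟙-≤-upTo t (suc N) rewrite ∑-upTo-suc (λ a → 𝟙 (t ≤? a)) N | ∑-𝟙-≤-upTo t N with t ≤? N
... | yes t≤N = cong +_ (≡.trans (ℕP.+-comm (N ∸ t) 1) (≡.sym (∸-suc t≤N)))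
  where ∸-suc : ∀ {t N} → t ≤ N → suc N ∸ t ≡ suc (N ∸ t)
        ∸-suc z≤n       = refl
        ∸-suc (s≤s t≤N) = ∸-suc t≤N
... | no t≰N  = cong +_ (≡.trans (ℕP.+-identityʳ _)
                  (≡.trans (ℕP.m≤n⇒m∸n≡0 (ℕP.<⇒≤ N<t)) (≡.sym (ℕP.m≤n⇒m∸n≡0 N<t))))
  where N<t = ℕP.≰⇒> t≰N

∑-alternating-trivial : ∀ (W : ℕ → ℤ) → (∀ k → W (suc k) ≡ + 0) →
                        ∀ K → ∑ (map (λ k → sign k * W k) (upTo (suc K))) ≡ W 0
∑-alternating-trivial W W≡0 zero    = ≡.trans (ℤP.+-identityʳ _) (ℤP.*-identityˡ (W 0))
∑-alternating-trivial W W≡0 (suc K) rewrite ∑-upTo-suc (λ k → sign k * W k) (suc K)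
  | ∑-alternating-trivial W W≡0 K | W≡0 K =
  ≡.trans (cong (λ z → W 0 + z) (ℤP.*-zeroʳ (sign (suc K)))) (ℤP.+-identityʳ (W 0))

∑-alternating-telescope : ∀ (W N : ℕ → ℤ) → W 0 ≡ N 0 → (∀ k → W (suc k) ≡ N (suc k) + N k) →
                          ∀ K → ∑ (map (λ k → sign k * W k) (upTo (suc K))) ≡ sign K * N K
∑-alternating-telescope W N W₀ Wₛ zero    = ≡.trans (ℤP.+-identityʳ _) (cong ((+ 1) *_) W₀)
∑-alternating-telescope W N W₀ Wₛ (suc K) rewrite ∑-upTo-suc (λ k → sign k * W k) (suc K)
  | ∑-alternating-telescope W N W₀ Wₛ K | Wₛ K = cancel (sign K) (N K) (N (suc K))
  where cancel : ∀ s x y → s * x + (- s) * (y + x) ≡ (- s) * y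
        cancel = solve-∀

box : ∀ {m} → (Fin m → ℕ) → List (Vec ℕ m)
box {zero}  ν = Vec.[] ∷ []
box {suc m} ν = cartesianProductWith Vec._∷_ (upTo (ν zero)) (box (ν ∘ suc))

box-unique : ∀ {m} (ν : Fin m → ℕ) → Unique (box ν)
box-unique {zero}  ν = All.[] ∷ AllPairs.[]
box-unique {suc m} ν = cartesianProductWith⁺ Vec._∷_ ∷-injective (upTo⁺ (ν zero)) (box-unique (ν ∘ suc))

∈-box : ∀ {m} {ν : Fin m → ℕ} (α : Vec ℕ m) → (∀ i → lookup α i ℕ.< ν i) → α ∈ₗ box ν
∈-box Vec.[]        α<ν = here refl
∈-box (a Vec.∷ α)  α<ν = ∈-cartesianProductWith⁺ Vec._∷_ (∈-upTo⁺ (α<ν zero)) (∈-box α (α<ν ∘ suc))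

∏-∑-expand : ∀ {m} (ν : Fin m → ℕ) (φ : Fin m → ℕ → ℤ) →
  ∏ (map (λ i → ∑ (map (φ i) (upTo (ν i)))) (allFin m))
    ≡ ∑ (map (λ α → ∏ (map (λ i → φ i (lookup α i)) (allFin m))) (box ν))
∏-∑-expand {zero}  ν φ = refl
∏-∑-expand {suc m} ν φ = begin
  ∏ (map (λ i → ∑ (map (φ i) (upTo (ν i)))) (allFin (suc m)))
    ≡⟨ cong ∏ (map-allFin-suc (λ i → ∑ (map (φ i) (upTo (ν i))))) ⟩
  ∑ (map (φ zero) (upTo (ν zero))) * ∏ (map (λ i → ∑ (map (φ (suc i)) (upTo (ν (suc i))))) (allFin m))
    ≡⟨ cong (λ z → ∑ (map (φ zero) (upTo (ν zero))) * z) (∏-∑-expand (ν ∘ suc) (φ ∘ suc)) ⟩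
  ∑ (map (φ zero) (upTo (ν zero))) * ∑ (map tail (box (ν ∘ suc)))
    ≡⟨ ≡.sym (∑-distribʳ _ (φ zero) (upTo (ν zero))) ⟩
  ∑ (map (λ a → φ zero a * ∑ (map tail (box (ν ∘ suc)))) (upTo (ν zero)))
    ≡⟨ ∑-cong (λ a → ≡.sym (≡.trans (∑-cong (term-∷ a) (box (ν ∘ suc))) (∑-distribˡ (φ zero a) tail (box (ν ∘ suc)))))
              (upTo (ν zero)) ⟩
  ∑ (map (λ a → ∑ (map (term ∘ (a Vec.∷_)) (box (ν ∘ suc)))) (upTo (ν zero)))
    ≡⟨ ≡.sym (∑-cartesianProductWith term Vec._∷_ (upTo (ν zero)) (box (ν ∘ suc))) ⟩
  ∑ (map term (box ν))
    ∎
  where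
  open ≡.≡-Reasoning
  tail : Vec ℕ m → ℤ
  tail β = ∏ (map (λ i → φ (suc i) (lookup β i)) (allFin m))
  term : Vec ℕ (suc m) → ℤ
  term α = ∏ (map (λ i → φ i (lookup α i)) (allFin (suc m)))
  term-∷ : ∀ a β → term (a Vec.∷ β) ≡ φ zero a * tail β
  term-∷ a β = cong ∏ (map-allFin-suc (λ i → φ i (lookup (a Vec.∷ β) i)))

-- Chains of subsets

_≟ₛ_ : ∀ {m} (p q : Subset m) → Dec (p ≡ q)
_≟ₛ_ = ≡-dec Bool._≟_

subsets : (m : ℕ) → List (Subset m)
subsets zero    = Vec.[] ∷ []
subsets (suc m) = concatMap (λ p → (inside Vec.∷ p) ∷ (outside Vec.∷ p) ∷ []) (subsets m)

∈-subsets : ∀ {m} (p : Subset m) → p ∈ₗ subsets m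
∈-subsets Vec.[]             = here refl
∈-subsets (inside Vec.∷ p)  = ∈-concatMap⁺ _ (Any.map (λ { refl → here refl }) (∈-subsets p))
∈-subsets (outside Vec.∷ p) = ∈-concatMap⁺ _ (Any.map (λ { refl → there (here refl) }) (∈-subsets p))

∑-subsets-δ : ∀ {m} (M : Subset m) (f : Subset m → ℤ) →
              ∑ (map (λ I → if does (I ≟ₛ M) then f I else + 0) (subsets m)) ≡ f M
∑-subsets-δ {zero}  Vec.[] f = ℤP.+-identityʳ (f Vec.[])
∑-subsets-δ {suc m} (inside Vec.∷ M) f =
  ≡.trans (∑-concatMap _ _ (subsets m))
    (≡.trans (∑-cong (λ p → ℤP.+-identityʳ _) (subsets m)) (∑-subsets-δ M (f ∘ (inside Vec.∷_))))
∑-subsets-δ {suc m} (outside Vec.∷ M) f =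
  ≡.trans (∑-concatMap _ _ (subsets m))
    (≡.trans (∑-cong (λ p → ≡.trans (ℤP.+-identityˡ _) (ℤP.+-identityʳ _)) (subsets m))
      (∑-subsets-δ M (f ∘ (outside Vec.∷_))))

lookup-─ : ∀ {m} (p q : Subset m) i → lookup (p ─ q) i ≡ (if lookup q i then outside else lookup p i)
lookup-─ (x Vec.∷ p) (inside Vec.∷ q)  zero    = refl
lookup-─ (x Vec.∷ p) (outside Vec.∷ q) zero    = refl
lookup-─ (x Vec.∷ p) (y Vec.∷ q)       (suc i) = lookup-─ p q i

p⊆q∧p≢q⇒p⊂q : ∀ {m} {p q : Subset m} → p ⊆ q → p ≢ q → p ⊂ q
p⊆q∧p≢q⇒p⊂q {p = Vec.[]}          {Vec.[]}          p⊆q p≢q = contradiction refl p≢q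
p⊆q∧p≢q⇒p⊂q {p = inside Vec.∷ p}  {inside Vec.∷ q}  p⊆q p≢q =
  s⊂s (p⊆q∧p≢q⇒p⊂q (drop-∷-⊆ p⊆q) (p≢q ∘ cong (inside Vec.∷_)))
p⊆q∧p≢q⇒p⊂q {p = outside Vec.∷ p} {outside Vec.∷ q} p⊆q p≢q =
  s⊂s (p⊆q∧p≢q⇒p⊂q (drop-∷-⊆ p⊆q) (p≢q ∘ cong (outside Vec.∷_)))
p⊆q∧p≢q⇒p⊂q {p = outside Vec.∷ p} {inside Vec.∷ q}  p⊆q p≢q = out⊂in (drop-∷-⊆ p⊆q)
p⊆q∧p≢q⇒p⊂q {p = inside Vec.∷ p}  {outside Vec.∷ q} p⊆q p≢q with () ← p⊆q Vec.here

chains : ∀ {n p} {P : Pred (Subset n) p} → Decidable P → ℕ → Subset n → ℤ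
chains         P? zero    prev = + 1
chains {n = n} P? (suc k) prev =
  ∑ (map (λ I → if does (prev ⊂? I ×-dec P? I) then chains P? k I else + 0) (subsets n))

eulerChar : ∀ {n p} {P : Pred (Subset n) p} → Decidable P → ℤ
eulerChar {n} P? = ∑ (map (λ k → sign k * chains P? k ⊥) (upTo (suc n)))

eulerChar-empty : ∀ {n p} {P : Pred (Subset n) p} (P? : Decidable P) → (∀ I → ¬ P I) → eulerChar P? ≡ + 1
eulerChar-empty {n} P? ∅ =
  ∑-alternating-trivial (λ k → chains P? k ⊥) (λ k → ∑-zero (no-step {k} {⊥}) (subsets n)) n
  where
  no-step : ∀ {k prev} I → (if does (prev ⊂? I ×-dec P? I) then chains P? k I else + 0) ≡ + 0
  no-step {prev = prev} I with prev ⊂? I | P? I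
  ... | _ | yes PI = contradiction PI (∅ I)
  ... | yes _ | no _ = refl
  ... | no _  | no _ = refl

-- If P has a greatest element M, a chain of P either ends in M or is a chain of P ∖ {M},
-- so the alternating chain count telescopes to a count of chains in P ∖ {M} that are too long to exist.
module Cone {n p} {P : Pred (Subset n) p} (P? : Decidable P)
            (M : Subset n) (PM : P M) (top : ∀ {I} → P I → I ⊆ M) where

  P∖M? : Decidable (λ I → P I × I ≢ M)
  P∖M? I = P? I ×-dec ¬? (I ≟ₛ M)

  ⊂M : ∀ {I} → P I → I ≢ M → I ⊂ M
  ⊂M PI I≢M = p⊆q∧p≢q⇒p⊂q (top PI) I≢M

  nothing-above-M : ∀ k → chains P? (suc k) M ≡ + 0
  nothing-above-M k = ∑-zero none (subsets n)
    where
    none : ∀ I → (if does (M ⊂? I ×-dec P? I) then chains P? k I else + 0) ≡ + 0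
    none I with M ⊂? I | P? I
    ... | yes (_ , x , x∈I , x∉M) | yes PI = contradiction (top PI x∈I) x∉M
    ... | yes _ | no _ = refl
    ... | no _  | _    = refl

  chains-peel : ∀ k prev → prev ⊂ M →
    chains P? (suc k) prev
      ≡ chains P? k M + ∑ (map (λ I → if does (prev ⊂? I ×-dec P∖M? I) then chains P? k I else + 0) (subsets n))
  chains-peel k prev prev⊂M =
    ≡.trans (∑-cong split (subsets n))
      (≡.trans (∑-+ _ _ (subsets n)) (≡.cong₂ _+_ (∑-subsets-δ M (chains P? k)) refl))
    where
    split : ∀ I → (if does (prev ⊂? I ×-dec P? I) then chains P? k I else + 0)
                ≡ (if does (I ≟ₛ M) then chains P? k I else + 0)
                  + (if does (prev ⊂? I ×-dec P∖M? I) then chains P? k I else + 0)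
    split I with I ≟ₛ M
    split I | yes refl with prev ⊂? I | P? I
    ... | yes _ | yes _        = ≡.sym (ℤP.+-identityʳ _)
    ... | yes _ | no ¬PM       = contradiction PM ¬PM
    ... | no ¬prev⊂M | _       = contradiction prev⊂M ¬prev⊂M
    split I | no _ with prev ⊂? I | P? I
    ... | yes _ | yes _ = ≡.sym (ℤP.+-identityˡ _)
    ... | yes _ | no _  = refl
    ... | no _  | _     = refl

  chains-split : ∀ k prev → prev ⊂ M → chains P? (suc k) prev ≡ chains P∖M? (suc k) prev + chains P∖M? k prev
  chains-split zero    prev prev⊂M = ≡.trans (chains-peel zero prev prev⊂M) (ℤP.+-comm (+ 1) (chains P∖M? 1 prev))
  chains-split (suc k) prev prev⊂M rewrite chains-peel (suc k) prev prev⊂M | nothing-above-M k =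
    ≡.trans (ℤP.+-identityˡ _) (≡.trans (∑-cong step (subsets n)) (∑-+ _ _ (subsets n)))
    where
    step : ∀ I → (if does (prev ⊂? I ×-dec P∖M? I) then chains P? (suc k) I else + 0)
               ≡ (if does (prev ⊂? I ×-dec P∖M? I) then chains P∖M? (suc k) I else + 0)
                 + (if does (prev ⊂? I ×-dec P∖M? I) then chains P∖M? k I else + 0)
    step I with prev ⊂? I | P? I | I ≟ₛ M
    ... | yes _ | yes PI | no I≢M = chains-split k I (⊂M PI I≢M)
    ... | yes _ | yes _  | yes _  = refl
    ... | yes _ | no _   | _      = refl
    ... | no _  | _      | _      = refl

  chains-vanish : ∀ k prev → prev ⊂ M → ∣ M ∣ ≤ ∣ prev ∣ ℕ.+ k → chains P∖M? k prev ≡ + 0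
  chains-vanish zero    prev prev⊂M M≤prev =
    contradiction (ℕP.≤-trans M≤prev (ℕP.≤-reflexive (ℕP.+-identityʳ _))) (ℕP.<⇒≱ (p⊂q⇒∣p∣<∣q∣ prev⊂M))
  chains-vanish (suc k) prev prev⊂M M≤prev+k = ∑-zero vanish (subsets n)
    where
    vanish : ∀ I → (if does (prev ⊂? I ×-dec P∖M? I) then chains P∖M? k I else + 0) ≡ + 0
    vanish I with prev ⊂? I | P? I | I ≟ₛ M
    ... | yes _ | yes _  | yes _  = refl
    ... | yes _ | no _   | _      = refl
    ... | no _  | _      | _      = refl
    ... | yes prev⊂I | yes PI | no I≢M = chains-vanish k I (⊂M PI I≢M) (begin
      ∣ M ∣                   ≤⟨ M≤prev+k ⟩
      ∣ prev ∣ ℕ.+ suc k      ≡⟨ ℕP.+-suc ∣ prev ∣ k ⟩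
      suc ∣ prev ∣ ℕ.+ k      ≤⟨ ℕP.+-monoˡ-≤ k (p⊂q⇒∣p∣<∣q∣ prev⊂I) ⟩
      ∣ I ∣ ℕ.+ k             ∎)
      where open ℕP.≤-Reasoning

  eulerChar-cone : Nonempty M → eulerChar P? ≡ + 0
  eulerChar-cone (x , x∈M) = begin
    eulerChar P?                    ≡⟨ ∑-alternating-telescope (λ k → chains P? k ⊥) (λ k → chains P∖M? k ⊥)
                                         refl (λ k → chains-split k ⊥ ⊥⊂M) n ⟩
    sign n * chains P∖M? n ⊥       ≡⟨ cong (sign n *_) (chains-vanish n ⊥ ⊥⊂M M≤n) ⟩
    sign n * + 0                    ≡⟨ ℤP.*-zeroʳ (sign n) ⟩
    + 0                             ∎
    where
    open ≡.≡-Reasoning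
    ⊥⊂M : ⊥ ⊂ M
    ⊥⊂M = ⊥⊆ , x , x∈M , ∉⊥
    M≤n : ∣ M ∣ ≤ ∣ ⊥ {n} ∣ ℕ.+ n
    M≤n rewrite ∣⊥∣≡0 n = ∣p∣≤n M

greatest-element : ∀ {n p} {P : Pred (Subset n) p} → Decidable P →
  (∀ {I J} → P I → P J → ∃ λ K → P K × I ∪ J ⊆ K) →
  ∀ {I} → P I → ∃ λ M → P M × (∀ {J} → P J → J ⊆ M)
greatest-element {n} {P = P} P? join PI with absorb (subsets n) PI
  where
  absorb : ∀ xs {K} → P K → ∃ λ M → P M × K ⊆ M × (∀ {J} → J ∈ₗ xs → P J → J ⊆ M)
  absorb []       {K} PK = K , PK , id , λ ()
  absorb (J ∷ xs) {K} PK with P? J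
  ... | no ¬PJ = let (M , PM , K⊆M , ub) = absorb xs PK in
    M , PM , K⊆M , λ { (here refl) PJ → contradiction PJ ¬PJ ; (there J∈xs) PJ → ub J∈xs PJ }
  ... | yes PJ = let (L , PL , K∪J⊆L) = join PK PJ ; (M , PM , L⊆M , ub) = absorb xs PL in
    M , PM , (λ x∈K → L⊆M (K∪J⊆L (p⊆p∪q J x∈K))) ,
    λ { (here refl) _ x∈J → L⊆M (K∪J⊆L (q⊆p∪q K J x∈J)) ; (there J∈xs) PJ′ → ub J∈xs PJ′ }
... | M , PM , _ , ub = M , PM , λ PJ → ub (∈-subsets _) PJ

-- Monotone monomial families

module MonotoneFamily {n : ℕ} (S : Subset n → Set) (S? : Decidable S) (ν : Subset n → Fin n → ℕ)
  (nonempty : ∀ I → S I → Nonempty I)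
  (monotone : ∀ I J i → S I → S J → I ⊂ J → i ∈ I → ν J i ≤ ν I i)
  (lcm-closed : ∀ I J → S I → S J →
     Σ[ L ∈ Subset n ] (S L × (I ∪ J) ⊆ L ×
       (∀ i → lookup (Family.expo S S? ν L) i ≤ lookup (Family.expo S S? ν I) i ⊔ lookup (Family.expo S S? ν J) i)))
  (singletons : ∀ i → S ⁅ i ⁆) where

  open Family S S? ν hiding (sign)

  -- Defs defines sign and allSubsets inside the parameterised module Family, so they do not reduce
  -- to the parameter-free sign and subsets used above for a variable argument.
  sign-agrees : ∀ k → Family.sign S S? ν k ≡ sign k
  sign-agrees zero    = refl
  sign-agrees (suc k) = cong -_ (sign-agrees k)

  allSubsets≡subsets : ∀ m → allSubsets m ≡ subsets m
  allSubsets≡subsets zero    = refl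
  allSubsets≡subsets (suc m) = cong (concatMap _) (allSubsets≡subsets m)

  lookup-expo : ∀ I i → lookup (expo I) i ≡ (if lookup I i then ν I i else 0)
  lookup-expo I i = lookup∘tabulate _ i

  ν≤ν₁ : ∀ {I i} → S I → i ∈ I → ν I i ≤ ν₁ i
  ν≤ν₁ {I} {i} SI i∈I with ⁅ i ⁆ ≟ₛ I
  ... | yes refl = ℕP.≤-refl
  ... | no ⁅i⁆≢I = monotone ⁅ i ⁆ I i (singletons i) SI (p⊆q∧p≢q⇒p⊂q ⁅i⁆⊆I ⁅i⁆≢I) (x∈⁅x⁆ i)
    where
    ⁅i⁆⊆I : ⁅ i ⁆ ⊆ I
    ⁅i⁆⊆I x∈⁅i⁆ = ≡.subst (_∈ I) (≡.sym (x∈⁅y⁆⇒x≡y i x∈⁅i⁆)) i∈I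

  -- Along a chain this is the exponent of x_i in the lcm of the chain's monomials: by MM2 the first set
  -- containing i carries the largest exponent.
  lcmExpo : List (Subset n) → Fin n → ℕ
  lcmExpo []      i = 0
  lcmExpo (I ∷ L) i = if lookup I i then ν I i else lcmExpo L i

  lcmExpo≤ν : ∀ {I} L i → S I → ChainAbove I L → i ∈ I → lcmExpo L i ≤ ν I i
  lcmExpo≤ν []      i SI _              i∈I = z≤n
  lcmExpo≤ν (J ∷ L) i SI (SJ , I⊂J , _) i∈I rewrite []=⇒lookup (proj₁ I⊂J i∈I) = monotone _ J i SI SJ I⊂J i∈I

  chainProd≡∏ : ∀ prev L → ChainAbove prev L →
    chainProd prev L ≡ ∏ (map (λ i → if lookup prev i then + 1 else + (ν₁ i ∸ lcmExpo L i)) (allFin n))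
  chainProd≡∏ prev [] _ = ∏-cong outside-prev (allFin n)
    where
    outside-prev : ∀ i → (if lookup (∁ prev) i then + ν₁ i else + 1) ≡ (if lookup prev i then + 1 else + ν₁ i)
    outside-prev i rewrite lookup-map i Bool.not prev with lookup prev i
    ... | true  = refl
    ... | false = refl
  chainProd≡∏ prev (I ∷ L) (SI , prev⊂I , chain) rewrite chainProd≡∏ I L chain =
    ≡.trans (≡.sym (∏-* _ _ (allFin n))) (∏-cong factor (allFin n))
    where
    factor : ∀ i → (if lookup (I ─ prev) i then + ν₁ i - + ν I i else + 1)
                   * (if lookup I i then + 1 else + (ν₁ i ∸ lcmExpo L i))
                 ≡ (if lookup prev i then + 1 else + (ν₁ i ∸ lcmExpo (I ∷ L) i))
    factor i rewrite lookup-─ I prev i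
      with lookup prev i in prev-i | lookup I i in I-i
    ... | true  | true  = refl
    ... | true  | false = contradiction (≡.trans (≡.sym ([]=⇒lookup (proj₁ prev⊂I (lookup⇒[]= i prev prev-i)))) I-i) λ ()
    ... | false | true  = ≡.trans (ℤP.*-identityʳ _) (≡.trans (ℤP.m-n≡m⊖n (ν₁ i) (ν I i))
                            (ℤP.⊖-≥ (ν≤ν₁ SI (lookup⇒[]= i I I-i))))
    ... | false | false = ℤP.*-identityˡ _

  lcmDivides : List (Subset n) → Vec ℕ n → ℤ
  lcmDivides L α = ∏ (map (λ i → 𝟙 (lcmExpo L i ≤? lookup α i)) (allFin n))

  chainProd≡∑-lcmDivides : ∀ L → IsChain L → chainProd ⊥ L ≡ ∑ (map (lcmDivides L) (box ν₁))
  chainProd≡∑-lcmDivides L chain = begin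
    chainProd ⊥ L
      ≡⟨ chainProd≡∏ ⊥ L chain ⟩
    ∏ (map (λ i → if lookup ⊥ i then + 1 else + (ν₁ i ∸ lcmExpo L i)) (allFin n))
      ≡⟨ ∏-cong (λ i → ≡.trans (cong (λ b → if b then + 1 else + (ν₁ i ∸ lcmExpo L i)) (lookup-replicate i outside))
                                 (≡.sym (∑-𝟙-≤-upTo (lcmExpo L i) (ν₁ i)))) (allFin n) ⟩
    ∏ (map (λ i → ∑ (map (λ a → 𝟙 (lcmExpo L i ≤? a)) (upTo (ν₁ i)))) (allFin n))
      ≡⟨ ∏-∑-expand ν₁ (λ i a → 𝟙 (lcmExpo L i ≤? a)) ⟩
    ∑ (map (lcmDivides L) (box ν₁))
      ∎
    where open ≡.≡-Reasoning

  Dividing : Vec ℕ n → Subset n → Set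
  Dividing α I = S I × expo I ∣ₘ α

  dividing? : ∀ α → Decidable (Dividing α)
  dividing? α I = S? I ×-dec expo I ∣ₘ? α

  lcmDivides-∷ : ∀ {I} L α → S I → ChainAbove I L → lcmDivides (I ∷ L) α ≡ 𝟙 (expo I ∣ₘ? α) * lcmDivides L α
  lcmDivides-∷ {I} L α SI chain =
    ≡.trans (∏-cong factor (allFin n))
      (≡.trans (∏-* (λ i → 𝟙 (lookup (expo I) i ≤? lookup α i)) (λ i → 𝟙 (lcmExpo L i ≤? lookup α i)) (allFin n))
        (cong (_* lcmDivides L α) (∏-𝟙≡𝟙-all (λ i → lookup (expo I) i ≤? lookup α i))))
    where
    factor : ∀ i → 𝟙 (lcmExpo (I ∷ L) i ≤? lookup α i)
                 ≡ 𝟙 (lookup (expo I) i ≤? lookup α i) * 𝟙 (lcmExpo L i ≤? lookup α i)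
    factor i rewrite lookup-expo I i with lookup I i in I-i
    ... | false = ≡.sym (ℤP.*-identityˡ _)
    ... | true with ν I i ≤? lookup α i | lcmExpo L i ≤? lookup α i
    ...   | yes _      | yes _     = refl
    ...   | yes νI≤α   | no L≰α    = contradiction (ℕP.≤-trans (lcmExpo≤ν L i SI chain (lookup⇒[]= i I I-i)) νI≤α) L≰α
    ...   | no _       | _         = refl

  ∑-allLists-suc : ∀ k (F : List (Subset n) → ℤ) →
    ∑ (map F (allLists (suc k))) ≡ ∑ (map (λ I → ∑ (map (λ L → F (I ∷ L)) (allLists k))) (subsets n))
  ∑-allLists-suc k F rewrite ≡.sym (allSubsets≡subsets n) =
    ≡.trans (∑-concatMap F _ (allSubsets n)) (∑-cong (λ I → ∑-map F (I ∷_) (allLists k)) (allSubsets n))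

  ∑-allLists-length : ∀ k (H : ℕ → List (Subset n) → ℤ) →
    ∑ (map (λ L → H (length L) L) (allLists k)) ≡ ∑ (map (H k) (allLists k))
  ∑-allLists-length zero    H = refl
  ∑-allLists-length (suc k) H =
    ≡.trans (∑-allLists-suc k _)
      (≡.trans (∑-cong (λ I → ∑-allLists-length k (λ m L → H (suc m) (I ∷ L))) (subsets n))
        (≡.sym (∑-allLists-suc k _)))

  ∑-allLists-chains : ∀ k prev α →
    ∑ (map (λ L → if does (chainAbove? prev L) then lcmDivides L α else + 0) (allLists k))
      ≡ chains (dividing? α) k prev
  ∑-allLists-chains zero    prev α = cong (_+ + 0) (∏-one (λ _ → refl) (allFin n))
  ∑-allLists-chains (suc k) prev α = ≡.trans (∑-allLists-suc k _) (∑-cong first (subsets n))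
    where
    first : ∀ I → ∑ (map (λ L → if does (chainAbove? prev (I ∷ L)) then lcmDivides (I ∷ L) α else + 0) (allLists k))
                ≡ (if does (prev ⊂? I ×-dec dividing? α I) then chains (dividing? α) k I else + 0)
    first I with prev ⊂? I | S? I
    ... | no _  | yes _  = ∑-zero (λ _ → refl) (allLists k)
    ... | no _  | no _   = ∑-zero (λ _ → refl) (allLists k)
    ... | yes _ | no _   = ∑-zero (λ _ → refl) (allLists k)
    ... | yes _ | yes SI = begin
      ∑ (map (λ L → if does (chainAbove? I L) then lcmDivides (I ∷ L) α else + 0) (allLists k))
        ≡⟨ ∑-cong peel (allLists k) ⟩
      ∑ (map (λ L → 𝟙 (expo I ∣ₘ? α) * (if does (chainAbove? I L) then lcmDivides L α else + 0)) (allLists k))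
        ≡⟨ ∑-distribˡ (𝟙 (expo I ∣ₘ? α)) _ (allLists k) ⟩
      𝟙 (expo I ∣ₘ? α) * ∑ (map (λ L → if does (chainAbove? I L) then lcmDivides L α else + 0) (allLists k))
        ≡⟨ cong (𝟙 (expo I ∣ₘ? α) *_) (∑-allLists-chains k I α) ⟩
      𝟙 (expo I ∣ₘ? α) * chains (dividing? α) k I
        ≡⟨ 𝟙-* (expo I ∣ₘ? α) _ ⟩
      (if does (expo I ∣ₘ? α) then chains (dividing? α) k I else + 0)
        ∎
      where
      open ≡.≡-Reasoning
      peel : ∀ L → (if does (chainAbove? I L) then lcmDivides (I ∷ L) α else + 0)
                 ≡ 𝟙 (expo I ∣ₘ? α) * (if does (chainAbove? I L) then lcmDivides L α else + 0)
      peel L with chainAbove? I L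
      ... | yes chain = lcmDivides-∷ L α SI chain
      ... | no _      = ≡.sym (ℤP.*-zeroʳ (𝟙 (expo I ∣ₘ? α)))

  chainSum≡∑-eulerChar : chainSum ≡ ∑ (map (λ α → eulerChar (dividing? α)) (box ν₁))
  chainSum≡∑-eulerChar = begin
    chainSum
      ≡⟨ cong ∑ (≡.sym (LP.map-id (concatMap (λ k → map chainSummand (allLists k)) (upTo (suc n))))) ⟩
    ∑ (map id (concatMap (λ k → map chainSummand (allLists k)) (upTo (suc n))))
      ≡⟨ ∑-concatMap id (λ k → map chainSummand (allLists k)) (upTo (suc n)) ⟩
    ∑ (map (λ k → ∑ (map id (map chainSummand (allLists k)))) (upTo (suc n)))
      ≡⟨ ∑-cong (λ k → ≡.trans (cong ∑ (LP.map-id (map chainSummand (allLists k))))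
               (≡.trans (∑-cong summand-sign (allLists k)) (∑-allLists-length k termOfLength))) (upTo (suc n)) ⟩
    ∑ (map (λ k → ∑ (map (termOfLength k) (allLists k))) (upTo (suc n)))
      ≡⟨ ∑-cong (λ k → ∑-cong (expandTerm k) (allLists k)) (upTo (suc n)) ⟩
    ∑ (map (λ k → ∑ (map (λ L → ∑ (map (boxTerm k L) (box ν₁))) (allLists k))) (upTo (suc n)))
      ≡⟨ ∑-cong (λ k → ∑-comm (boxTerm k) (allLists k) (box ν₁)) (upTo (suc n)) ⟩
    ∑ (map (λ k → ∑ (map (λ α → ∑ (map (λ L → boxTerm k L α) (allLists k))) (box ν₁))) (upTo (suc n)))
      ≡⟨ ∑-cong (λ k → ∑-cong (λ α → countChains k α) (box ν₁)) (upTo (suc n)) ⟩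
    ∑ (map (λ k → ∑ (map (λ α → sign k * chains (dividing? α) k ⊥) (box ν₁))) (upTo (suc n)))
      ≡⟨ ∑-comm (λ k α → sign k * chains (dividing? α) k ⊥) (upTo (suc n)) (box ν₁) ⟩
    ∑ (map (λ α → eulerChar (dividing? α)) (box ν₁))
      ∎
    where
    open ≡.≡-Reasoning
    chainSummand : List (Subset n) → ℤ
    chainSummand L = if does (chainAbove? ⊥ L) then chainTerm L else + 0
    termOfLength : ℕ → List (Subset n) → ℤ
    termOfLength k L = if does (chainAbove? ⊥ L) then sign k * chainProd ⊥ L else + 0
    summand-sign : ∀ L → chainSummand L ≡ termOfLength (length L) L
    summand-sign L with does (chainAbove? ⊥ L)
    ... | true  = cong (_* chainProd ⊥ L) (sign-agrees (length L))
    ... | false = refl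
    boxTerm : ℕ → List (Subset n) → Vec ℕ n → ℤ
    boxTerm k L α = sign k * (if does (chainAbove? ⊥ L) then lcmDivides L α else + 0)
    expandTerm : ∀ k L → termOfLength k L ≡ ∑ (map (boxTerm k L) (box ν₁))
    expandTerm k L with chainAbove? ⊥ L
    ... | yes chain = ≡.trans (cong (sign k *_) (chainProd≡∑-lcmDivides L chain)) (≡.sym (∑-distribˡ (sign k) _ (box ν₁)))
    ... | no _      = ≡.sym (∑-zero (λ _ → ℤP.*-zeroʳ (sign k)) (box ν₁))
    countChains : ∀ k α → ∑ (map (λ L → boxTerm k L α) (allLists k)) ≡ sign k * chains (dividing? α) k ⊥
    countChains k α = ≡.trans (∑-distribˡ (sign k) _ (allLists k)) (cong (sign k *_) (∑-allLists-chains k ⊥ α))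

  Divisible : Vec ℕ n → Set
  Divisible α = ∃ (Dividing α)

  divisible? : ∀ α → Dec (Divisible α)
  divisible? α = anySubset? (dividing? α)

  standard? : ∀ α → Dec (¬ Divisible α)
  standard? α = ¬? (divisible? α)

  dividing-join : ∀ {α I J} → Dividing α I → Dividing α J → ∃ λ K → Dividing α K × I ∪ J ⊆ K
  dividing-join {α} {I} {J} (SI , I∣α) (SJ , J∣α) with lcm-closed I J SI SJ
  ... | K , SK , I∪J⊆K , K≤I⊔J = K , (SK , λ i → ℕP.≤-trans (K≤I⊔J i) (ℕP.⊔-lub (I∣α i) (J∣α i))) , I∪J⊆K

  eulerChar-dividing : ∀ α → eulerChar (dividing? α) ≡ 𝟙 (standard? α)
  eulerChar-dividing α with divisible? α
  ... | no ¬div = eulerChar-empty (dividing? α) (λ I dI → ¬div (I , dI))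
  ... | yes (I , dI) with greatest-element (dividing? α) (dividing-join {α}) dI
  ...   | M , dM , top = Cone.eulerChar-cone (dividing? α) M dM top (nonempty M (proj₁ dM))

  standard⇒below-ν₁ : ∀ {α} → ¬ Divisible α → ∀ i → lookup α i ℕ.< ν₁ i
  standard⇒below-ν₁ {α} ¬div i with ν₁ i ≤? lookup α i
  ... | no ν₁≰α  = ℕP.≰⇒> ν₁≰α
  ... | yes ν₁≤α = contradiction (⁅ i ⁆ , singletons i , ⁅i⁆∣α) ¬div
    where
    ⁅i⁆∣α : expo ⁅ i ⁆ ∣ₘ α
    ⁅i⁆∣α j rewrite lookup-expo ⁅ i ⁆ j with lookup ⁅ i ⁆ j in j∈⁅i⁆
    ... | false = z≤n
    ... | true with refl ← x∈⁅y⁆⇒x≡y i (lookup⇒[]= j ⁅ i ⁆ j∈⁅i⁆) = ν₁≤α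

  standardMonomials : List (Vec ℕ n)
  standardMonomials = filter standard? (box ν₁)

  standardMonomials-unique : Unique standardMonomials
  standardMonomials-unique = filter⁺ standard? (box-unique ν₁)

  ∈-standardMonomials⁻ : ∀ {α} → α ∈ₗ standardMonomials → ¬ Divisible α
  ∈-standardMonomials⁻ α∈ = proj₂ (∈-filter⁻ standard? {xs = box ν₁} α∈)

  ∈-standardMonomials⁺ : ∀ {α} → ¬ Divisible α → α ∈ₗ standardMonomials
  ∈-standardMonomials⁺ {α} ¬div = ∈-filter⁺ standard? (∈-box α (standard⇒below-ν₁ {α} ¬div)) ¬div

proposition8p4 : ∀ {c ℓ : Level} (K : Field c ℓ) (n : ℕ)
    (S : Subset n → Set) (S? : Decidable S)
    (ν : Subset n → Fin n → ℕ) →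
    (∀ I → S I → Nonempty I) →
    (∀ I J i → S I → S J → I ⊂ J → i ∈ I → ν J i ≤ ν I i) →
    (∀ I J → S I → S J →
    Σ[ L ∈ Subset n ] (S L × (I ∪ J) ⊆ L ×
    (∀ i → lookup (Family.expo S S? ν L) i
    ≤ lookup (Family.expo S S? ν I) i ⊔ lookup (Family.expo S S? ν J) i))) →
    (∀ i → S ⁅ i ⁆) →
    Σ[ d ∈ ℕ ]
    ( PolyRing.QuotientDim K n
    (PolyRing.InIdeal K n S (Family.expo S S? ν)) d
    × (+ d ≡ Family.chainSum S S? ν) )
proposition8p4 K n S S? ν nonempty monotone lcm-closed singletons =
  length standardMonomials , Basis.quotientDim , count
  where
  open MonotoneFamily S S? ν nonempty monotone lcm-closed singletons
  open Family S S? ν using (ν₁; expo; chainSum)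
  module Basis = StandardMonomials.Basis K n S expo divisible? standardMonomials
                   standardMonomials-unique ∈-standardMonomials⁻ ∈-standardMonomials⁺
  count : + length standardMonomials ≡ chainSum
  count = begin
    + length standardMonomials                         ≡⟨ ∑-𝟙≡length-filter standard? (box ν₁) ⟨
    ∑ (map (𝟙 ∘ standard?) (box ν₁))                   ≡⟨ ∑-cong eulerChar-dividing (box ν₁) ⟨
    ∑ (map (λ α → eulerChar (dividing? α)) (box ν₁))   ≡⟨ chainSum≡∑-eulerChar ⟨
    chainSum                                           ∎
    where open ≡.≡-Reasoning
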